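{- For any $u,u'\in W_0$ there is at most one $z_1\in\Lambda^+$ such that $\delta_{w_0d_u^{ -1},\,d_{u'}w_0,\,z_1w_0}\neq0$. Moreover, if $\delta_{w_0d_u^{ -1},\,d_{u'}w_0,\,z_1w_0}\neq0$, then $\delta_{w_0d_u^{ -1},\,d_{u'}w_0,\,z_1w_0}=1$ and $z_1\in\{0,x,y\}$.
   Context: Let $W$ be the affine Weyl group of type $\widetilde A_2$ on $S=\{r,s,t\}$ with $(rs)^3=(st)^3=(rt)^3=1$, $W_0=\langle s,t\rangle$, $w_0=sts$, and $\widetilde W=\Omega\ltimes W$ with $\Omega=\{e,\omega,\omega^2\}$ cyclic, $r\omega=\omega s$, $s\omega=\omega t$, $t\omega=\omega r$. Let $\mathcal H$ be the Hecke algebra of $W$ over $\mathbb Z[q^{1/2},q^{ -1/2}]$ with Kazhdan–Lusztig basis $C_w$, and $\widetilde{\mathcal H}=\mathbb Z[\Omega]\otimes\mathcal H$ the twisted tensor product (Hecke algebra of $\widetilde W$), with basis $C_{\omega w}=\omega\otimes C_w$ ($\omega\in\Omega,w\in W$), where $\omega C_w\omega^{ -1}=C_{\omega w\omega^{ -1}}$. Write $C_aC_b=\sum_z h_{a,b,z}C_z$. For $z$ with $\mathbf a(z)=3$ (in particular $z=z_1w_0$, $z_1\in\Lambda^+$), $\delta_{a,b,z}$ denotes the coefficient of $q^{(\mathbf a(z)-1)/2}=q$ in $h_{a,b,z}$. Here $\Lambda^+=\{x^my^n:m,n\in\mathbb N\}$ with $x=\omega tr$, $y=\omega^2sr$ (written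 additively, $0$ is the identity), and $d_e=e$, $d_s=\omega r$, $d_t=\omega^2r$, $d_{st}=\omega^2$, $d_{ts}=\omega$, $d_{sts}=r$. -}

module Defs where

open import Data.Bool using (Bool; true; false; if_then_else_; _∧_; not)
open import Data.Nat as ℕ using (ℕ; zero; suc)
open import Data.Integer as ℤ using (ℤ; +_; -_; _-_)
open import Data.Fin using (Fin; toℕ) renaming (zero to f0; suc to fs)
open import Data.Vec using (Vec; []; _∷_; lookup)
open import Data.List using (List; []; _∷_; _++_; foldr; filter; map)
open import Data.Maybe using (Maybe; just; nothing)
open import Data.Product using (_×_; _,_; proj₁; proj₂; Σ; ∃; ∃-syntax)
open import Relation.Nullary using (does)
open import Relation.Binary.PropositionalEquality using (_≡_)
import Data.Vec.Properties as VecP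
import Data.Product.Properties as ProdP
import Data.Fin.Properties as FinP
import Data.Integer.Properties as ℤP

-- W~ is realised as the group of affine permutations f : ℤ → ℤ with
-- f(i+3) = f(i)+3, modulo the central element i ↦ i+3.  Such f is given by
-- f(i) = σ(i) + 3 λ_i (i = 1,2,3, σ ∈ S₃), λ ∈ ℤ³ taken modulo (1,1,1);
-- we normalise λ₃ = 0.  An element is (σ , λ₁ , λ₂), with positions
-- 1,2,3 encoded as Fin 3.  Product = composition of maps.

Perm3 : Set
Perm3 = Vec (Fin 3) 3

W~ : Set
W~ = Perm3 × ℤ × ℤ

_≟W_ : (x y : W~) → Relation.Nullary.Dec (x ≡ y)
_≟W_ = ProdP.≡-dec (VecP.≡-dec FinP._≟_) (ProdP.≡-dec ℤ._≟_ ℤ._≟_)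

_==W_ : W~ → W~ → Bool
x ==W y = does (x ≟W y)

perm : W~ → Fin 3 → Fin 3
perm (σ , _) i = lookup σ i

lam : W~ → Fin 3 → ℤ
lam (_ , l₁ , l₂) f0 = l₁
lam (_ , l₁ , l₂) (fs f0) = l₂
lam (_ , l₁ , l₂) (fs (fs f0)) = + 0

mk : (Fin 3 → Fin 3) → (Fin 3 → ℤ) → W~
mk σ l = (σ f0 ∷ σ (fs f0) ∷ σ (fs (fs f0)) ∷ [])
       , l f0 - l (fs (fs f0)) , l (fs f0) - l (fs (fs f0))

infixl 7 _·_
_·_ : W~ → W~ → W~
f · g = mk (λ i → perm f (perm g i)) (λ i → lam f (perm g i) ℤ.+ lam g i)

inv : W~ → W~
inv f = mk τ (λ i → - lam f (τ i))
  where
  pre : Fin 3 → Fin 3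
  pre i = if does (perm f f0 FinP.≟ i) then f0
          else if does (perm f (fs f0) FinP.≟ i) then fs f0
          else fs (fs f0)
  τ : Fin 3 → Fin 3
  τ = pre

-- Coxeter length (Shi's formula):
-- ℓ(f) = Σ_{1≤i<j≤3} | ⌊ (f(j) - f(i)) / 3 ⌋ |
--      = Σ_{i<j} | λ_j - λ_i - [σ(i) > σ(j)] |
pairTerm : W~ → Fin 3 → Fin 3 → ℕ
pairTerm f i j =
  ℤ.∣ lam f j - lam f i - (if toℕ (perm f j) ℕ.<ᵇ toℕ (perm f i) then + 1 else + 0) ∣

len : W~ → ℕ
len f = pairTerm f f0 (fs f0) ℕ.+ pairTerm f f0 (fs (fs f0))
        ℕ.+ pairTerm f (fs f0) (fs (fs f0))

-- Distinguished elements.  s = s₁, r = s₂ (transpositions of positions),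
-- t = s₀ (the affine reflection), ω = shift i ↦ i+1.
e : W~
e = mk (λ i → i) (λ _ → + 0)

s : W~
s = mk (λ { f0 → fs f0 ; (fs f0) → f0 ; (fs (fs f0)) → fs (fs f0) }) (λ _ → + 0)

r : W~
r = mk (λ { f0 → f0 ; (fs f0) → fs (fs f0) ; (fs (fs f0)) → fs f0 }) (λ _ → + 0)

t : W~
t = mk (λ { f0 → fs (fs f0) ; (fs f0) → fs f0 ; (fs (fs f0)) → f0 })
       (λ { f0 → - (+ 1) ; (fs f0) → + 0 ; (fs (fs f0)) → + 1 })

ω : W~
ω = mk (λ { f0 → fs f0 ; (fs f0) → fs (fs f0) ; (fs (fs f0)) → f0 })
       (λ { f0 → + 0 ; (fs f0) → + 0 ; (fs (fs f0)) → + 1 })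

gens : List W~
gens = s ∷ r ∷ t ∷ []

-- Laurent polynomials in q^{1/2}: finite lists of (exponent of q^{1/2},
-- coefficient), kept with distinct exponents and nonzero coefficients.

Laur : Set
Laur = List (ℤ × ℤ)

insL : ℤ × ℤ → Laur → Laur
insL (k , c) [] = if does (c ℤ.≟ + 0) then [] else (k , c) ∷ []
insL (k , c) ((k' , c') ∷ p) =
  if does (k ℤ.≟ k')
  then (if does ((c ℤ.+ c') ℤ.≟ + 0) then p else (k , c ℤ.+ c') ∷ p)
  else (k' , c') ∷ insL (k , c) p

_+L_ : Laur → Laur → Laur
p +L p' = foldr insL p' p

_*L_ : Laur → Laur → Laur
p *L p' = foldr (λ { (k , c) acc → foldr (λ { (k' , c') → insL (k ℤ.+ k' , c ℤ.* c') }) acc p' }) [] p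

coeffL : ℤ → Laur → ℤ
coeffL k [] = + 0
coeffL k ((k' , c) ∷ p) = (if does (k ℤ.≟ k') then c else + 0) ℤ.+ coeffL k p

mono : ℤ → ℤ → Laur
mono c k = insL (k , c) []

-- The Hecke algebra of W~: elements Σ p_w T_w, as lists (w , p_w) with
-- distinct w and nonzero p_w.  Relations: T_ω T_w = T_{ωw} (ℓ(ω)=0),
-- T_s T_w = T_{sw} if ℓ(sw) > ℓ(w), and (q-1) T_w + q T_{sw} otherwise.

Hecke : Set
Hecke = List (W~ × Laur)

insH : W~ × Laur → Hecke → Hecke
insH (w , p) [] = if Data.List.null p then [] else (w , p) ∷ []
  where import Data.List
insH (w , p) ((w' , p') ∷ h) =
  if w ==W w'
  then (let p'' = p +L p' in if Data.List.null p'' then h else (w , p'') ∷ h)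
  else (w' , p') ∷ insH (w , p) h
  where import Data.List

_+H_ : Hecke → Hecke → Hecke
h +H h' = foldr insH h' h

scaleH : Laur → Hecke → Hecke
scaleH c h = foldr (λ { (w , p) acc → insH (w , c *L p) acc }) [] h

T : W~ → Hecke
T w = (w , mono (+ 1) (+ 0)) ∷ []

leftTgen : W~ → Hecke → Hecke
leftTgen g h = foldr step [] h
  where
  step : W~ × Laur → Hecke → Hecke
  step (w , p) acc =
    if len w ℕ.<ᵇ len (g · w)
    then insH (g · w , p) acc
    else insH (w , (mono (+ 1) (+ 2) +L mono (- (+ 1)) (+ 0)) *L p)
           (insH (g · w , mono (+ 1) (+ 2) *L p) acc)

leftTlen0 : W~ → Hecke → Hecke
leftTlen0 y h = foldr (λ { (w , p) acc → insH (y · w , p) acc }) [] h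

descent : W~ → Maybe W~
descent x = go gens
  where
  go : List W~ → Maybe W~
  go [] = nothing
  go (g ∷ gs) = if len (g · x) ℕ.<ᵇ len x then just g else go gs

-- left multiplication by T_x, using x = g₁ ⋯ g_k y with g_i ∈ S, ℓ(y) = 0
-- (fuel: ℓ(x))
leftTfuel : ℕ → W~ → Hecke → Hecke
leftTfuel zero x h = leftTlen0 x h
leftTfuel (suc n) x h with descent x
... | nothing = leftTlen0 x h
... | just g  = leftTgen g (leftTfuel n (g · x) h)

leftT : W~ → Hecke → Hecke
leftT x = leftTfuel (len x) x

_*H_ : Hecke → Hecke → Hecke
h *H h' = foldr (λ { (x , p) acc → scaleH p (leftT x h') +H acc }) [] h

-- Kazhdan–Lusztig basis (Lusztig's convention):
--   C_w = Σ_{y ≤ w} ε_y ε_w q_w^{1/2} q_y^{-1} \bar P_{y,w} T_y,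
-- so C_s = q^{-1/2} T_s - q^{1/2} and C_ω = T_ω for ℓ(ω) = 0.
-- Constructed by the Kazhdan–Lusztig induction (KL79, (2.3.a)): for
-- g ∈ S with g v > v,
--   C_{gv} = C_g C_v - Σ_{z < v, gz < z} μ(z,v) C_z ,
-- where μ(z,v) (the coefficient of q^{(ℓ(v)-ℓ(z)-1)/2} in P_{z,v}) is read
-- off from the T_z–coefficient of C_v: it equals minus the coefficient of
-- (q^{1/2})^{1-ℓ(z)}.

Cgen : W~ → Hecke
Cgen g = (g , mono (+ 1) (- (+ 1))) ∷ (e , mono (- (+ 1)) (+ 1)) ∷ []

coeffH : W~ → Hecke → Laur
coeffH w [] = []
coeffH w ((w' , p) ∷ h) = if w ==W w' then p +L coeffH w h else coeffH w h

KLfuel : ℕ → W~ → Hecke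
KLfuel zero x = T x
KLfuel (suc n) x with descent x
... | nothing = T x
... | just g  = foldr corr (Cgen g *H Cv) Cv
  where
  v : W~
  v = g · x
  Cv : Hecke
  Cv = KLfuel n v
  corr : W~ × Laur → Hecke → Hecke
  corr (z , p) acc =
    if not (z ==W v) ∧ (len (g · z) ℕ.<ᵇ len z)
    then scaleH (mono (coeffL (+ 1 - + (len z)) p) (+ 0)) (KLfuel n z) +H acc
    else acc

C : W~ → Hecke
C x = KLfuel (len x) x

-- Structure constants: C_a C_b = Σ_z h_{a,b,z} C_z.
-- The C–expansion of h is computed by the unitriangularity of C w.r.t. T
-- (T_z–coefficient of C_z is q^{-ℓ(z)/2}): process the T–terms of maximal
-- length L downwards.  Starting level: any bound on the lengths in the
-- support (for C_a C_b, ℓ(a)+ℓ(b)).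

levelTerms : ℕ → Hecke → Hecke
levelTerms L h = map (λ { (z , p) → z , (mono (+ 1) (+ L) *L p) })
                     (filter (λ { (z , _) → len z ℕ.≟ L }) h)

toC : ℕ → Hecke → List (W~ × Laur)
toC zero h = levelTerms zero h
toC (suc L) h = lvl ++ toC L (h +H rest)
  where
  lvl : Hecke
  lvl = levelTerms (suc L) h
  rest : Hecke
  rest = foldr (λ { (z , c) acc → scaleH (mono (- (+ 1)) (+ 0) *L c) (C z) +H acc }) [] lvl

hcoef : W~ → W~ → W~ → Laur
hcoef a b z = coeffH z (toC (len a ℕ.+ len b) (C a *H C b))

-- δ_{a,b,z}: the coefficient of q = (q^{1/2})^2 in h_{a,b,z}
-- (i.e. of q^{(a(z)-1)/2} for a(z) = 3)
δ : W~ → W~ → W~ → ℤ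
δ a b z = coeffL (+ 2) (hcoef a b z)

data W₀ : Set where
  `e `s `t `st `ts `sts : W₀

w₀ : W~
w₀ = s · t · s

d : W₀ → W~
d `e   = e
d `s   = ω · r
d `t   = ω · ω · r
d `st  = ω · ω
d `ts  = ω
d `sts = r

x : W~
x = ω · t · r

y : W~
y = ω · ω · s · r

_^_ : W~ → ℕ → W~
g ^ zero  = e
g ^ suc n = g · (g ^ n)

Λ⁺ : W~ → Set
Λ⁺ z = ∃[ m ] ∃[ n ] z ≡ (x ^ m) · (y ^ n)

{-# OPTIONS --safe #-}
module Submission where

-- Writing z₁ = xᵐyⁿ, one has ℓ(z₁w₀) = 3 + 2(m + n), whereas
-- ℓ(w₀d_u⁻¹) + ℓ(d_{u'}w₀) ≤ 8 for every u, u'.  Since C_aC_b is a combination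
-- of T_z with ℓ(z) ≤ ℓ(a) + ℓ(b) and C is unitriangular with respect to T,
-- h_{a,b,z} = 0 as soon as ℓ(z) > ℓ(a) + ℓ(b).  So only the six z₁ with
-- m + n ≤ 2 can contribute, and for those the structure constants are
-- evaluated: for each pair (u, u'), δ is 1 at no more than one z₁, which is
-- e, x or y, and 0 elsewhere.

open import Defs
open import Data.Bool using (if_then_else_)
open import Data.Nat as ℕ using (ℕ; zero; suc; _≤_; _<_; s≤s)
import Data.Nat.Properties as ℕP
import Data.Nat.Tactic.RingSolver as ℕSolver
open import Data.Integer as ℤ using (ℤ; +_; -_; _-_)
import Data.Integer.Tactic.RingSolver as ℤSolver
open import Data.Fin using () renaming (zero to f0; suc to fs)
open import Data.Vec using (_∷_; [])
open import Data.List using (List; []; _∷_)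
open import Data.List.Relation.Unary.All as All using (All; []; _∷_; all?)
open import Data.List.Relation.Unary.All.Properties using (++⁺; all-filter; map⁺)
open import Data.List.Relation.Unary.Any using (here; there)
open import Data.List.Membership.Propositional using (_∈_)
open import Data.Maybe using (Maybe; just; nothing)
open import Data.Maybe.Properties using (just-injective)
open import Data.Product using (_×_; _,_; proj₁; ∃-syntax)
open import Data.Sum using (_⊎_; inj₁; inj₂)
open import Data.Empty using (⊥-elim)
open import Data.Unit using (tt)
open import Relation.Nullary using (yes; no)
open import Relation.Nullary.Decidable using (toWitness)
open import Relation.Binary.PropositionalEquality

coeffH-∉ : ∀ z h → All (λ p → z ≢ proj₁ p) h → coeffH z h ≡ []
coeffH-∉ z []            []            = refl
coeffH-∉ z ((w , _) ∷ h) (z≢w ∷ z∉h) with z ≟W w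
... | yes z≡w = ⊥-elim (z≢w z≡w)
... | no _    = coeffH-∉ z h z∉h

levelTerms-len≤ : ∀ L h → All (λ p → len (proj₁ p) ≤ L) (levelTerms L h)
levelTerms-len≤ L h =
  map⁺ (All.map ℕP.≤-reflexive (all-filter (λ { (z , _) → len z ℕ.≟ L }) h))

toC-len≤ : ∀ L h → All (λ p → len (proj₁ p) ≤ L) (toC L h)
toC-len≤ zero    h = levelTerms-len≤ zero h
toC-len≤ (suc L) h =
  ++⁺ (levelTerms-len≤ (suc L) h) (All.map ℕP.m≤n⇒m≤1+n (toC-len≤ L _))

hcoef-len> : ∀ a b z → len a ℕ.+ len b < len z → hcoef a b z ≡ []
hcoef-len> a b z ℓa+ℓb<ℓz = coeffH-∉ z _
  (All.map (λ ℓw≤ z≡w → ℕP.<⇒≱ ℓa+ℓb<ℓz (subst (λ w → len w ≤ _) (sym z≡w) ℓw≤))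
           (toC-len≤ (len a ℕ.+ len b) (C a *H C b)))

δ-len> : ∀ a b z → len a ℕ.+ len b < len z → δ a b z ≡ + 0
δ-len> a b z ℓa+ℓb<ℓz = cong (coeffL (+ 2)) (hcoef-len> a b z ℓa+ℓb<ℓz)

idPerm : Perm3
idPerm = f0 ∷ fs f0 ∷ fs (fs f0) ∷ []

x^-coords : ∀ m → x ^ m ≡ (idPerm , + 0 , + m)
x^-coords zero    = refl
x^-coords (suc m) rewrite x^-coords m | ℕP.+-identityʳ m = refl

y^-coords : ∀ n → y ^ n ≡ (idPerm , + n , + n)
y^-coords zero    = refl
y^-coords (suc n) rewrite y^-coords n | ℕP.+-identityʳ n = refl

Λ⁺-coords : ∀ m n → x ^ m · y ^ n ≡ (idPerm , + n , + (m ℕ.+ n))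
Λ⁺-coords m n
  rewrite x^-coords m | y^-coords n | ℕP.+-identityʳ n | ℕP.+-identityʳ (m ℕ.+ n) = refl

len-translation·w₀ : ∀ m n →
  len ((idPerm , + n , + (m ℕ.+ n)) · w₀) ≡ suc n ℕ.+ suc m ℕ.+ suc (m ℕ.+ n)
len-translation·w₀ m n rewrite ℕP.+-identityʳ (m ℕ.+ n) =
  cong₂ ℕ._+_ (cong₂ ℕ._+_ (cong ℤ.∣_∣ (pair₀₁ (+ m) (+ n))) (cong ℤ.∣_∣ (pair₀₂ (+ m) (+ n))))
              (cong ℤ.∣_∣ (pair₁₂ (+ m) (+ n)))
  where
  pair₀₁ : ∀ M N → - + 2 - (M ℤ.+ N) - ((N - + 1) - (M ℤ.+ N)) ℤ.+ + 0 ≡ - (+ 1 ℤ.+ N)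
  pair₀₁ = ℤSolver.solve-∀
  pair₀₂ : ∀ M N → + 0 - ((N - + 1) - (M ℤ.+ N)) ℤ.+ + 0 ≡ + 1 ℤ.+ M
  pair₀₂ = ℤSolver.solve-∀
  pair₁₂ : ∀ M N → + 0 - (- + 2 - (M ℤ.+ N)) - + 1 ≡ + 1 ℤ.+ (M ℤ.+ N)
  pair₁₂ = ℤSolver.solve-∀

len-Λ⁺·w₀ : ∀ m n → len (x ^ m · y ^ n · w₀) ≡ 3 ℕ.+ 2 ℕ.* (m ℕ.+ n)
len-Λ⁺·w₀ m n = begin
  len (x ^ m · y ^ n · w₀)                ≡⟨ cong (λ z → len (z · w₀)) (Λ⁺-coords m n) ⟩
  len ((idPerm , + n , + (m ℕ.+ n)) · w₀) ≡⟨ len-translation·w₀ m n ⟩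
  suc n ℕ.+ suc m ℕ.+ suc (m ℕ.+ n)       ≡⟨ summands m n ⟩
  3 ℕ.+ 2 ℕ.* (m ℕ.+ n)                   ∎
  where
  open ≡-Reasoning
  summands : ∀ m n → suc n ℕ.+ suc m ℕ.+ suc (m ℕ.+ n) ≡ 3 ℕ.+ 2 ℕ.* (m ℕ.+ n)
  summands = ℕSolver.solve-∀

allW₀ : List W₀
allW₀ = `e ∷ `s ∷ `t ∷ `st ∷ `ts ∷ `sts ∷ []

∈-allW₀ : ∀ u → u ∈ allW₀
∈-allW₀ `e   = here refl
∈-allW₀ `s   = there (here refl)
∈-allW₀ `t   = there (there (here refl))
∈-allW₀ `st  = there (there (there (here refl)))
∈-allW₀ `ts  = there (there (there (there (here refl))))
∈-allW₀ `sts = there (there (there (there (there (here refl)))))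

all-W₀² : {P : W₀ → W₀ → Set} → All (λ u → All (P u) allW₀) allW₀ → ∀ u u' → P u u'
all-W₀² table u u' = All.lookup (All.lookup table (∈-allW₀ u)) (∈-allW₀ u')

len-factors≤8 : ∀ u u' → len (w₀ · inv (d u)) ℕ.+ len (d u' · w₀) ≤ 8
len-factors≤8 = all-W₀² (toWitness {a? = all? (λ u → all? (λ u' →
  len (w₀ · inv (d u)) ℕ.+ len (d u' · w₀) ℕP.≤? 8) allW₀) allW₀} tt)

data Corner : Set where
  e′ x′ y′ : Corner

corner : Corner → W~
corner e′ = e
corner x′ = x
corner y′ = y

≡corner⇒≡e⊎x⊎y : ∀ {z} c → z ≡ corner c → z ≡ e ⊎ z ≡ x ⊎ z ≡ y
≡corner⇒≡e⊎x⊎y e′ refl = inj₁ refl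
≡corner⇒≡e⊎x⊎y x′ refl = inj₂ (inj₁ refl)
≡corner⇒≡e⊎x⊎y y′ refl = inj₂ (inj₂ refl)

indicator : Maybe Corner → W~ → ℤ
indicator nothing  z = + 0
indicator (just c) z = if z ==W corner c then + 1 else + 0

indicator-≢0 : ∀ k z → indicator k z ≢ + 0 →
  ∃[ c ] (k ≡ just c × z ≡ corner c × indicator k z ≡ + 1)
indicator-≢0 nothing  z ind≢0 = ⊥-elim (ind≢0 refl)
indicator-≢0 (just c) z ind≢0 with z ≟W corner c
... | yes z≡c = c , refl , z≡c , refl
... | no _    = ⊥-elim (ind≢0 refl)

δ-support : W₀ → W₀ → Maybe Corner
δ-support `e   `s   = just x′
δ-support `e   `t   = just y′
δ-support `e   `sts = just e′
δ-support `s   `e   = just y′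
δ-support `s   `st  = just x′
δ-support `s   `ts  = just e′
δ-support `t   `e   = just x′
δ-support `t   `st  = just e′
δ-support `t   `ts  = just y′
δ-support `st  `s   = just y′
δ-support `st  `t   = just e′
δ-support `st  `sts = just x′
δ-support `ts  `s   = just e′
δ-support `ts  `t   = just x′
δ-support `ts  `sts = just y′
δ-support `sts `e   = just e′
δ-support `sts `st  = just y′
δ-support `sts `ts  = just x′
δ-support _    _    = nothing

smallExponents : List (ℕ × ℕ)
smallExponents = (0 , 0) ∷ (0 , 1) ∷ (0 , 2) ∷ (1 , 0) ∷ (1 , 1) ∷ (2 , 0) ∷ []

∈smallExponents : ∀ {m n} → m ℕ.+ n ≤ 2 → (m , n) ∈ smallExponents
∈smallExponents {0} {0} _ = here refl
∈smallExponents {0} {1} _ = there (here refl)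
∈smallExponents {0} {2} _ = there (there (here refl))
∈smallExponents {1} {0} _ = there (there (there (here refl)))
∈smallExponents {1} {1} _ = there (there (there (there (here refl))))
∈smallExponents {2} {0} _ = there (there (there (there (there (here refl)))))
∈smallExponents {0} {suc (suc (suc _))} (s≤s (s≤s ()))
∈smallExponents {1} {suc (suc _)}       (s≤s (s≤s ()))
∈smallExponents {2} {suc _}             (s≤s (s≤s ()))
∈smallExponents {suc (suc (suc _))}     (s≤s (s≤s ()))

δ-small : ∀ u u' → All (λ { (m , n) → δ (w₀ · inv (d u)) (d u' · w₀) (x ^ m · y ^ n · w₀)
                                      ≡ indicator (δ-support u u') (x ^ m · y ^ n) })
                       smallExponents
δ-small `e   `e   = refl ∷ refl ∷ refl ∷ refl ∷ refl ∷ refl ∷ []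
δ-small `e   `s   = refl ∷ refl ∷ refl ∷ refl ∷ refl ∷ refl ∷ []
δ-small `e   `t   = refl ∷ refl ∷ refl ∷ refl ∷ refl ∷ refl ∷ []
δ-small `e   `st  = refl ∷ refl ∷ refl ∷ refl ∷ refl ∷ refl ∷ []
δ-small `e   `ts  = refl ∷ refl ∷ refl ∷ refl ∷ refl ∷ refl ∷ []
δ-small `e   `sts = refl ∷ refl ∷ refl ∷ refl ∷ refl ∷ refl ∷ []
δ-small `s   `e   = refl ∷ refl ∷ refl ∷ refl ∷ refl ∷ refl ∷ []
δ-small `s   `s   = refl ∷ refl ∷ refl ∷ refl ∷ refl ∷ refl ∷ []
δ-small `s   `t   = refl ∷ refl ∷ refl ∷ refl ∷ refl ∷ refl ∷ []
δ-small `s   `st  = refl ∷ refl ∷ refl ∷ refl ∷ refl ∷ refl ∷ []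
δ-small `s   `ts  = refl ∷ refl ∷ refl ∷ refl ∷ refl ∷ refl ∷ []
δ-small `s   `sts = refl ∷ refl ∷ refl ∷ refl ∷ refl ∷ refl ∷ []
δ-small `t   `e   = refl ∷ refl ∷ refl ∷ refl ∷ refl ∷ refl ∷ []
δ-small `t   `s   = refl ∷ refl ∷ refl ∷ refl ∷ refl ∷ refl ∷ []
δ-small `t   `t   = refl ∷ refl ∷ refl ∷ refl ∷ refl ∷ refl ∷ []
δ-small `t   `st  = refl ∷ refl ∷ refl ∷ refl ∷ refl ∷ refl ∷ []
δ-small `t   `ts  = refl ∷ refl ∷ refl ∷ refl ∷ refl ∷ refl ∷ []
δ-small `t   `sts = refl ∷ refl ∷ refl ∷ refl ∷ refl ∷ refl ∷ []
δ-small `st  `e   = refl ∷ refl ∷ refl ∷ refl ∷ refl ∷ refl ∷ []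
δ-small `st  `s   = refl ∷ refl ∷ refl ∷ refl ∷ refl ∷ refl ∷ []
δ-small `st  `t   = refl ∷ refl ∷ refl ∷ refl ∷ refl ∷ refl ∷ []
δ-small `st  `st  = refl ∷ refl ∷ refl ∷ refl ∷ refl ∷ refl ∷ []
δ-small `st  `ts  = refl ∷ refl ∷ refl ∷ refl ∷ refl ∷ refl ∷ []
δ-small `st  `sts = refl ∷ refl ∷ refl ∷ refl ∷ refl ∷ refl ∷ []
δ-small `ts  `e   = refl ∷ refl ∷ refl ∷ refl ∷ refl ∷ refl ∷ []
δ-small `ts  `s   = refl ∷ refl ∷ refl ∷ refl ∷ refl ∷ refl ∷ []
δ-small `ts  `t   = refl ∷ refl ∷ refl ∷ refl ∷ refl ∷ refl ∷ []
δ-small `ts  `st  = refl ∷ refl ∷ refl ∷ refl ∷ refl ∷ refl ∷ []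
δ-small `ts  `ts  = refl ∷ refl ∷ refl ∷ refl ∷ refl ∷ refl ∷ []
δ-small `ts  `sts = refl ∷ refl ∷ refl ∷ refl ∷ refl ∷ refl ∷ []
δ-small `sts `e   = refl ∷ refl ∷ refl ∷ refl ∷ refl ∷ refl ∷ []
δ-small `sts `s   = refl ∷ refl ∷ refl ∷ refl ∷ refl ∷ refl ∷ []
δ-small `sts `t   = refl ∷ refl ∷ refl ∷ refl ∷ refl ∷ refl ∷ []
δ-small `sts `st  = refl ∷ refl ∷ refl ∷ refl ∷ refl ∷ refl ∷ []
δ-small `sts `ts  = refl ∷ refl ∷ refl ∷ refl ∷ refl ∷ refl ∷ []
δ-small `sts `sts = refl ∷ refl ∷ refl ∷ refl ∷ refl ∷ refl ∷ []

δ-Λ⁺·w₀-≢0 : ∀ u u' m n → δ (w₀ · inv (d u)) (d u' · w₀) (x ^ m · y ^ n · w₀) ≢ + 0 →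
  δ (w₀ · inv (d u)) (d u' · w₀) (x ^ m · y ^ n · w₀) ≡ indicator (δ-support u u') (x ^ m · y ^ n)
δ-Λ⁺·w₀-≢0 u u' m n δ≢0 with m ℕ.+ n ℕP.≤? 2
... | yes m+n≤2 = All.lookup (δ-small u u') (∈smallExponents {m} {n} m+n≤2)
... | no  m+n≰2 = ⊥-elim (δ≢0 (δ-len> (w₀ · inv (d u)) (d u' · w₀) (x ^ m · y ^ n · w₀) (begin-strict
  len (w₀ · inv (d u)) ℕ.+ len (d u' · w₀) ≤⟨ len-factors≤8 u u' ⟩
  8                                        <⟨ ℕP.+-monoʳ-≤ 3 (ℕP.*-monoʳ-≤ 2 (ℕP.≰⇒> m+n≰2)) ⟩
  3 ℕ.+ 2 ℕ.* (m ℕ.+ n)                    ≡⟨ len-Λ⁺·w₀ m n ⟨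
  len (x ^ m · y ^ n · w₀)                 ∎)))
  where open ℕP.≤-Reasoning

δ-≢0⇒corner : ∀ u u' {z₁} → Λ⁺ z₁ → δ (w₀ · inv (d u)) (d u' · w₀) (z₁ · w₀) ≢ + 0 →
  ∃[ c ] (δ-support u u' ≡ just c × z₁ ≡ corner c
          × δ (w₀ · inv (d u)) (d u' · w₀) (z₁ · w₀) ≡ + 1)
δ-≢0⇒corner u u' (m , n , refl) δ≢0
  with δ≡ind ← δ-Λ⁺·w₀-≢0 u u' m n δ≢0
  with c , supp , z₁≡c , ind≡1 ← indicator-≢0 _ _ (subst (_≢ + 0) δ≡ind δ≢0)
  = c , supp , z₁≡c , trans δ≡ind ind≡1

proposition4p4 : (u u' : W₀) →
    ((z₁ z₁' : W~) → Λ⁺ z₁ → Λ⁺ z₁' →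
      δ (w₀ · inv (d u)) (d u' · w₀) (z₁ · w₀) ≢ + 0 →
      δ (w₀ · inv (d u)) (d u' · w₀) (z₁' · w₀) ≢ + 0 →
      z₁ ≡ z₁')
    × ((z₁ : W~) → Λ⁺ z₁ →
      δ (w₀ · inv (d u)) (d u' · w₀) (z₁ · w₀) ≢ + 0 →
      (δ (w₀ · inv (d u)) (d u' · w₀) (z₁ · w₀) ≡ + 1)
      × (z₁ ≡ e ⊎ z₁ ≡ x ⊎ z₁ ≡ y))
proposition4p4 u u' = unique , value
  where
  unique : (z₁ z₁' : W~) → Λ⁺ z₁ → Λ⁺ z₁' →
    δ (w₀ · inv (d u)) (d u' · w₀) (z₁ · w₀) ≢ + 0 →
    δ (w₀ · inv (d u)) (d u' · w₀) (z₁' · w₀) ≢ + 0 → z₁ ≡ z₁'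
  unique z₁ z₁' Λz₁ Λz₁' δ≢0 δ'≢0
    with c  , supp  , z₁≡c   , _ ← δ-≢0⇒corner u u' Λz₁ δ≢0
       | c' , supp' , z₁'≡c' , _ ← δ-≢0⇒corner u u' Λz₁' δ'≢0
    = trans z₁≡c (trans (cong corner (just-injective (trans (sym supp) supp'))) (sym z₁'≡c'))

  value : (z₁ : W~) → Λ⁺ z₁ → δ (w₀ · inv (d u)) (d u' · w₀) (z₁ · w₀) ≢ + 0 →
    (δ (w₀ · inv (d u)) (d u' · w₀) (z₁ · w₀) ≡ + 1) × (z₁ ≡ e ⊎ z₁ ≡ x ⊎ z₁ ≡ y)
  value z₁ Λz₁ δ≢0 with c , _ , z₁≡c , δ≡1 ← δ-≢0⇒corner u u' Λz₁ δ≢0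
    = δ≡1 , ≡corner⇒≡e⊎x⊎y c z₁≡c
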